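{- Let $Z\subseteq R\times C$ be a set of positions and let $(i,j)\in R\times C$ be a position such that $\mathrm{rank}(Z\cup\{(i,j)\})=\mathrm{rank}(Z)+1$. Then for every positive integer $k$, $I_k(Z\cup\{(i,j)\})=I_k(Z)/i$, where $I_k(Z)/i=\{X\subseteq R: X\cup\{i\}\in I_k(Z)\}$.
   Context: $R$ is a finite set of rows and $C$ a finite set of columns. A set of positions is independent if no two of its positions share a row or column; the rank of a set of positions is the size of its largest independent subset. A file is a row or column; a set of files covers $Z$ if every position of $Z$ lies in one of its files. A $(k-1)$-cover of $Z$ is a cover with exactly $k-1$ files and a partial $(k-1)$-cover is a subset of a $(k-1)$-cover. $I_k(Z)$ is the family of all sets of rows $X\subseteq R$ that are partial $(k-1)$-covers of $Z$. -}

module Defs where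

open import Data.Nat using (ℕ; _≤_; _∸_)
open import Data.Fin using (Fin; _≟_)
open import Data.Bool using (Bool; true; _∨_; _∧_)
open import Data.Product using (_×_; _,_; proj₁; proj₂; ∃)
open import Data.Sum using (_⊎_; inj₁; inj₂)
open import Data.List using (List; length)
open import Data.List.Relation.Unary.All using (All)
open import Data.List.Relation.Unary.AllPairs using (AllPairs)
open import Data.List.Relation.Unary.Unique.Propositional using (Unique)
open import Data.List.Membership.Propositional using () renaming (_∈_ to _∈ₗ_)
open import Data.Fin.Subset using (Subset) renaming (_∈_ to _∈ₛ_)
open import Relation.Binary.PropositionalEquality using (_≡_; _≢_)
open import Relation.Nullary.Decidable using (⌊_⌋)

Pos : ℕ → ℕ → Set
Pos m n = Fin m × Fin n

PosSet : ℕ → ℕ → Set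
PosSet m n = Fin m → Fin n → Bool

_∈Z_ : ∀ {m n} → Pos m n → PosSet m n → Set
(i , j) ∈Z Z = Z i j ≡ true

addPos : ∀ {m n} → PosSet m n → Pos m n → PosSet m n
addPos Z (i , j) i' j' = Z i' j' ∨ (⌊ i' ≟ i ⌋ ∧ ⌊ j' ≟ j ⌋)

-- A finite set of positions given as a duplicate-free list; independent means
-- no two of its positions share a row or a column (this forces distinctness).
IndependentSubsetOf : ∀ {m n} → PosSet m n → List (Pos m n) → Set
IndependentSubsetOf Z L =
  All (λ p → p ∈Z Z) L ×
  AllPairs (λ p q → proj₁ p ≢ proj₁ q × proj₂ p ≢ proj₂ q) L

IsRank : ∀ {m n} → PosSet m n → ℕ → Set
IsRank Z r =
  (∃ λ L → IndependentSubsetOf Z L × length L ≡ r) ×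
  (∀ L → IndependentSubsetOf Z L → length L ≤ r)

File : ℕ → ℕ → Set
File m n = Fin m ⊎ Fin n

Covers : ∀ {m n} → PosSet m n → List (File m n) → Set
Covers Z F = ∀ i j → (i , j) ∈Z Z → (inj₁ i ∈ₗ F) ⊎ (inj₂ j ∈ₗ F)

IsCoverOfSize : ∀ {m n} → PosSet m n → ℕ → List (File m n) → Set
IsCoverOfSize Z t F = Unique F × length F ≡ t × Covers Z F

I : ∀ {m n} → ℕ → PosSet m n → Subset m → Set
I k Z X = ∃ λ F → IsCoverOfSize Z (k ∸ 1) F × (∀ r → r ∈ₛ X → inj₁ r ∈ₗ F)

-- Because (i , j) raises the rank, removing it from a maximum matching of Z ∪ {(i , j)}
-- leaves a maximum matching M of Z avoiding column j.  A cover of Z ∪ {(i , j)} without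
-- row i contains column j; exchange that column for row i.  The resulting set G of files
-- may miss positions of Z, but only in freeable columns c: some maximum matching of Z
-- avoids c and agrees with M on the rows outside G.  At a missed position (a , t), the
-- matching freeing t must use row a (otherwise (a , t) could be added to it), so M has an
-- entry (a , b).  Column b lies in G: (a , b) is not missed, row a is not in G, and b is
-- not freeable, as every matching agreeing with M on row a contains (a , b).  Exchanging
-- column b for row a keeps the invariant, b being freed by the matching whose entry
-- (a , b) is moved to (a , t).  Each exchange removes a column, so the process stops at a
-- cover of Z of the original size containing row i.  This is the augmenting-path
-- argument, each path encoded by the matching shifted along it.
module Submission where

open import Defs
open import Data.Nat using (ℕ; zero; suc; _≤_)
open import Data.Nat.Properties using (1+n≰n; suc-injective)
open import Data.Fin using (Fin; zero; suc; _≟_)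
open import Data.Fin.Subset using (Subset; _∪_; ⁅_⁆) renaming (_∈_ to _∈ₛ_)
open import Data.Fin.Subset.Properties using (x∈p∪q⁻; x∈⁅y⁆⇒x≡y; x∈⁅x⁆; p⊆p∪q; q⊆p∪q)
open import Data.Product using (_×_; _,_; ∃; ∃₂; proj₁; proj₂)
import Data.Product.Properties as Product
open import Data.Sum using (_⊎_; inj₁; inj₂; [_,_])
import Data.Sum.Properties as Sum
open import Data.Bool using (true; false)
open import Data.Bool.Properties using (∨-zeroʳ)
open import Data.List using (List; []; _∷_; length)
open import Data.List.Properties using (length-removeAt′)
open import Data.List.Relation.Unary.Any using (here; there; _─_; index)
open import Data.List.Relation.Unary.All as All using (All; _∷_)
open import Data.List.Relation.Unary.All.Properties using (─⁺)
open import Data.List.Relation.Unary.AllPairs using (AllPairs; _∷_)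
open import Data.List.Relation.Unary.Unique.Propositional using (Unique)
open import Data.List.Membership.Propositional using (_∈_; _∉_)
import Data.List.Membership.DecPropositional as DecMembership
open import Relation.Binary.Definitions using (Symmetric)
open import Relation.Binary.PropositionalEquality using (_≡_; _≢_; refl; sym; trans; cong; subst)
open import Relation.Nullary using (yes; no; contradiction)
open import Function using (id; _∘_)
open import Function.Bundles using (_⇔_; mk⇔; Equivalence)

module _ {A : Set} where

  length-─ : ∀ {x} {xs : List A} (p : x ∈ xs) → length xs ≡ suc (length (xs ─ p))
  length-─ {xs = xs} p = length-removeAt′ xs (index p)

  ∈-─⁻ : ∀ {x y} {xs : List A} (p : x ∈ xs) → y ∈ (xs ─ p) → y ∈ xs
  ∈-─⁻ (here _)  q         = there q
  ∈-─⁻ (there p) (here e)  = here e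
  ∈-─⁻ (there p) (there q) = there (∈-─⁻ p q)

  ∈-─⁺ : ∀ {x y} {xs : List A} (p : x ∈ xs) → y ∈ xs → y ≢ x → y ∈ (xs ─ p)
  ∈-─⁺ (here refl) (here refl) y≢x = contradiction refl y≢x
  ∈-─⁺ (here _)    (there q)   _   = q
  ∈-─⁺ (there p)   (here e)    _   = here e
  ∈-─⁺ (there p)   (there q)   y≢x = there (∈-─⁺ p q y≢x)

  AllPairs-─⁺ : ∀ {R : A → A → Set} {x} {xs : List A} (p : x ∈ xs) →
                AllPairs R xs → AllPairs R (xs ─ p)
  AllPairs-─⁺ (here _)  (_ ∷ rs)  = rs
  AllPairs-─⁺ (there p) (r ∷ rs) = ─⁺ p r ∷ AllPairs-─⁺ p rs

  AllPairs-─-related : ∀ {R : A → A → Set} → Symmetric R → ∀ {x y} {xs : List A} (p : x ∈ xs) →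
                       AllPairs R xs → y ∈ (xs ─ p) → R x y
  AllPairs-─-related R-sym (here refl) (r ∷ _)  q           = All.lookup r q
  AllPairs-─-related R-sym (there p)   (r ∷ _)  (here refl) = R-sym (All.lookup r p)
  AllPairs-─-related R-sym (there p)   (_ ∷ rs) (there q)   = AllPairs-─-related R-sym p rs q

  Unique-swap : ∀ {x y} {xs : List A} (p : x ∈ xs) → y ∉ xs → Unique xs → Unique (y ∷ (xs ─ p))
  Unique-swap p y∉xs unique = All.tabulate (λ { z∈ refl → y∉xs (∈-─⁻ p z∈) }) ∷ AllPairs-─⁺ p unique

all-or-counterexample : ∀ {n} {P Q : Fin n → Set} → (∀ x → P x ⊎ Q x) → (∀ x → P x) ⊎ ∃ Q
all-or-counterexample {zero}  P⊎Q = inj₁ λ ()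
all-or-counterexample {suc n} P⊎Q with P⊎Q zero | all-or-counterexample (P⊎Q ∘ suc)
... | inj₂ q | _            = inj₂ (zero , q)
... | inj₁ _ | inj₂ (x , q) = inj₂ (suc x , q)
... | inj₁ p | inj₁ ps      = inj₁ λ { zero → p ; (suc x) → ps x }

module _ {m n : ℕ} where

  _⊆ʳ_ : List (File m n) → List (File m n) → Set
  G ⊆ʳ G′ = ∀ {x} → inj₁ x ∈ G → inj₁ x ∈ G′

  ⊆ʳ-swap : ∀ {a b} {G : List (File m n)} (p : inj₂ b ∈ G) → G ⊆ʳ (inj₁ a ∷ (G ─ p))
  ⊆ʳ-swap p x∈G = there (∈-─⁺ p x∈G λ ())

  columnCount : List (File m n) → ℕ
  columnCount []           = 0
  columnCount (inj₁ _ ∷ G) = columnCount G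
  columnCount (inj₂ _ ∷ G) = suc (columnCount G)

  columnCount-─ : ∀ {b} {G : List (File m n)} (p : inj₂ b ∈ G) →
                  columnCount G ≡ suc (columnCount (G ─ p))
  columnCount-─ (here refl)                 = refl
  columnCount-─ {G = inj₁ _ ∷ _} (there p) = columnCount-─ p
  columnCount-─ {G = inj₂ _ ∷ _} (there p) = cong suc (columnCount-─ p)

  Missed : PosSet m n → List (File m n) → Set
  Missed Z G = ∃₂ λ x y → (x , y) ∈Z Z × inj₁ x ∉ G × inj₂ y ∉ G

  open DecMembership (Sum.≡-dec (_≟_ {m}) (_≟_ {n})) using (_∈?_)

  covered-or-missed-at : ∀ (Z : PosSet m n) G x y →
    ((x , y) ∈Z Z → inj₁ x ∈ G ⊎ inj₂ y ∈ G) ⊎ ((x , y) ∈Z Z × inj₁ x ∉ G × inj₂ y ∉ G)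
  covered-or-missed-at Z G x y with Z x y | inj₁ x ∈? G | inj₂ y ∈? G
  ... | false | _       | _       = inj₁ λ ()
  ... | true  | yes x∈G | _       = inj₁ λ _ → inj₁ x∈G
  ... | true  | no _    | yes y∈G = inj₁ λ _ → inj₂ y∈G
  ... | true  | no x∉G  | no y∉G  = inj₂ (refl , x∉G , y∉G)

  covers-or-missed : ∀ (Z : PosSet m n) G → Covers Z G ⊎ Missed Z G
  covers-or-missed Z G = all-or-counterexample λ x → all-or-counterexample (covered-or-missed-at Z G x)

module _ {m n : ℕ} {Z : PosSet m n} {i : Fin m} {j : Fin n} where

  ∈-addPos⁻ : ∀ {x y} → (x , y) ∈Z addPos Z (i , j) → (x , y) ∈Z Z ⊎ (x , y) ≡ (i , j)
  ∈-addPos⁻ {x} {y} xy∈Z′ with Z x y | x ≟ i | y ≟ j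
  ∈-addPos⁻ _  | true  | _        | _        = inj₁ refl
  ∈-addPos⁻ _  | false | yes refl | yes refl = inj₂ refl
  ∈-addPos⁻ () | false | yes _    | no _
  ∈-addPos⁻ () | false | no _     | _

  ∈-addPos⁺ : ∀ {x y} → (x , y) ∈Z Z → (x , y) ∈Z addPos Z (i , j)
  ∈-addPos⁺ xy∈Z rewrite xy∈Z = refl

  new∈addPos : (i , j) ∈Z addPos Z (i , j)
  new∈addPos with i ≟ i | j ≟ j
  ... | yes _  | yes _  = ∨-zeroʳ (Z i j)
  ... | no i≢i | _      = contradiction refl i≢i
  ... | _      | no j≢j = contradiction refl j≢j

  Covers-addPos⁻ : ∀ {F} → Covers (addPos Z (i , j)) F → Covers Z F
  Covers-addPos⁻ covers x y xy∈Z = covers x y (∈-addPos⁺ xy∈Z)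

  Covers-addPos⁺ : ∀ {F} → Covers Z F → inj₁ i ∈ F → Covers (addPos Z (i , j)) F
  Covers-addPos⁺ covers i∈F x y xy∈Z′ with ∈-addPos⁻ xy∈Z′
  ... | inj₁ xy∈Z = covers x y xy∈Z
  ... | inj₂ refl = inj₁ i∈F

  newColumn∈ : ∀ {F} → Covers (addPos Z (i , j)) F → inj₁ i ∉ F → inj₂ j ∈ F
  newColumn∈ covers i∉F = [ (λ i∈F → contradiction i∈F i∉F) , id ] (covers i j new∈addPos)

Apart : ∀ {m n} → Pos m n → Pos m n → Set
Apart p q = proj₁ p ≢ proj₁ q × proj₂ p ≢ proj₂ q

Apart-sym : ∀ {m n} → Symmetric (Apart {m} {n})
Apart-sym (x≢x′ , y≢y′) = x≢x′ ∘ sym , y≢y′ ∘ sym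

AvoidsColumn : ∀ {m n} → Fin n → List (Pos m n) → Set
AvoidsColumn c N = ∀ {x y} → (x , y) ∈ N → y ≢ c

rowEntry : ∀ {m n} (a : Fin m) (L : List (Pos m n)) → (∃ λ b → (a , b) ∈ L) ⊎ (∀ {b} → (a , b) ∉ L)
rowEntry a [] = inj₂ λ ()
rowEntry a ((x , y) ∷ L) with x ≟ a | rowEntry a L
... | yes refl | _            = inj₁ (y , here refl)
... | no _     | inj₁ (b , p) = inj₁ (b , there p)
... | no x≢a   | inj₂ none    = inj₂ λ { (here refl) → x≢a refl ; (there p) → none p }

module _ {m n : ℕ} where

  open DecMembership (Product.≡-dec (_≟_ {m}) (_≟_ {n})) using (_∈?_)

  matching-avoiding-new-column : ∀ {r} {Z : PosSet m n} {i j} →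
    IsRank Z r → IsRank (addPos Z (i , j)) (suc r) →
    ∃ λ M → IndependentSubsetOf Z M × length M ≡ r × AvoidsColumn j M
  matching-avoiding-new-column {r} {Z} {i} {j} (_ , maximal) ((L , (L⊆Z′ , L-apart) , L-len) , _)
    with (i , j) ∈? L
  ... | no ij∉L = contradiction (subst (_≤ r) L-len (maximal L (All.tabulate inZ , L-apart))) 1+n≰n
    where
    inZ : ∀ {e} → e ∈ L → e ∈Z Z
    inZ e∈L with ∈-addPos⁻ {Z = Z} {i} {j} (All.lookup L⊆Z′ e∈L)
    ... | inj₁ e∈Z = e∈Z
    ... | inj₂ refl = contradiction e∈L ij∉L
  ... | yes ij∈L = (L ─ ij∈L) , (All.tabulate inZ , AllPairs-─⁺ ij∈L L-apart) ,
                   suc-injective (trans (sym (length-─ ij∈L)) L-len) ,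
                   λ e∈ → proj₂ (apart e∈) ∘ sym
    where
    apart : ∀ {e} → e ∈ (L ─ ij∈L) → Apart (i , j) e
    apart = AllPairs-─-related Apart-sym ij∈L L-apart
    inZ : ∀ {e} → e ∈ (L ─ ij∈L) → e ∈Z Z
    inZ e∈ with ∈-addPos⁻ {Z = Z} {i} {j} (All.lookup L⊆Z′ (∈-─⁻ ij∈L e∈))
    ... | inj₁ e∈Z = e∈Z
    ... | inj₂ refl = contradiction refl (proj₁ (apart e∈))

module Exchange {m n r : ℕ} (Z : PosSet m n)
  (maximal : ∀ L → IndependentSubsetOf Z L → length L ≤ r)
  (M : List (Pos m n)) (M-independent : IndependentSubsetOf Z M) (M-length : length M ≡ r) where

  open DecMembership (Sum.≡-dec (_≟_ {m}) (_≟_ {n})) using (_∈?_)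

  AgreesOutside : List (File m n) → List (Pos m n) → Set
  AgreesOutside G N = ∀ {x y} → inj₁ x ∉ G → (x , y) ∈ N ⇔ (x , y) ∈ M

  Freeable : List (File m n) → Fin n → Set
  Freeable G c = ∃ λ N → IndependentSubsetOf Z N × length N ≡ r × AvoidsColumn c N × AgreesOutside G N

  M-freeable : ∀ {G c} → AvoidsColumn c M → Freeable G c
  M-freeable avoids = M , M-independent , M-length , avoids , λ _ → mk⇔ id id

  Freeable-mono : ∀ {G G′ c} → G ⊆ʳ G′ → Freeable G c → Freeable G′ c
  Freeable-mono G⊆G′ (N , independent , len , avoids , agrees) =
    N , independent , len , avoids , λ x∉G′ → agrees (x∉G′ ∘ G⊆G′)

  AlmostCovers : List (File m n) → Set
  AlmostCovers G = ∀ x y → (x , y) ∈Z Z → inj₁ x ∈ G ⊎ inj₂ y ∈ G ⊎ Freeable G y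

  Covers⇒AlmostCovers : ∀ {G} → Covers Z G → AlmostCovers G
  Covers⇒AlmostCovers covers x y xy∈Z = [ inj₁ , inj₂ ∘ inj₁ ] (covers x y xy∈Z)

  missedRow-matched : ∀ {G a t} → inj₁ a ∉ G → (a , t) ∈Z Z → Freeable G t → ∃ λ b → (a , b) ∈ M
  missedRow-matched {a = a} {t} a∉G at∈Z (N , (N⊆Z , N-apart) , N-len , avoids , agrees)
    with rowEntry a M
  ... | inj₁ entry = entry
  ... | inj₂ none  = contradiction (subst (λ l → suc l ≤ r) N-len augmented) 1+n≰n
    where
    apart : ∀ {e} → e ∈ N → Apart (a , t) e
    apart {x , y} e∈N = (λ { refl → none (Equivalence.to (agrees a∉G) e∈N) }) , avoids e∈N ∘ sym
    augmented : length ((a , t) ∷ N) ≤ r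
    augmented = maximal ((a , t) ∷ N) (at∈Z ∷ N⊆Z , All.tabulate apart ∷ N-apart)

  partnerColumn∈ : ∀ {G a b} → AlmostCovers G → inj₁ a ∉ G → (a , b) ∈ M → inj₂ b ∈ G
  partnerColumn∈ almost a∉G ab∈M with almost _ _ (All.lookup (proj₁ M-independent) ab∈M)
  ... | inj₁ a∈G                              = contradiction a∈G a∉G
  ... | inj₂ (inj₁ b∈G)                       = b∈G
  ... | inj₂ (inj₂ (_ , _ , _ , avoids , agrees)) =
    contradiction refl (avoids (Equivalence.from (agrees a∉G) ab∈M))

  Freeable-shift : ∀ {G G′ a b t} → G ⊆ʳ G′ → inj₁ a ∈ G′ → inj₁ a ∉ G →
                   (a , t) ∈Z Z → (a , b) ∈ M → Freeable G t → Freeable G′ b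
  Freeable-shift {G} {G′} {a} {b} {t} G⊆G′ a∈G′ a∉G at∈Z ab∈M
                 (N , (N⊆Z , N-apart) , N-len , avoids , agrees) =
    (a , t) ∷ (N ─ ab∈N) ,
    (at∈Z ∷ ─⁺ ab∈N N⊆Z , All.tabulate apart ∷ AllPairs-─⁺ ab∈N N-apart) ,
    trans (sym (length-─ ab∈N)) N-len , avoids′ , agrees′
    where
    ab∈N : (a , b) ∈ N
    ab∈N = Equivalence.from (agrees a∉G) ab∈M
    related : ∀ {e} → e ∈ (N ─ ab∈N) → Apart (a , b) e
    related = AllPairs-─-related Apart-sym ab∈N N-apart
    apart : ∀ {e} → e ∈ (N ─ ab∈N) → Apart (a , t) e
    apart e∈ = proj₁ (related e∈) , avoids (∈-─⁻ ab∈N e∈) ∘ sym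
    avoids′ : AvoidsColumn b ((a , t) ∷ (N ─ ab∈N))
    avoids′ (here refl) = avoids ab∈N ∘ sym
    avoids′ (there e∈)  = proj₂ (related e∈) ∘ sym
    agrees′ : AgreesOutside G′ ((a , t) ∷ (N ─ ab∈N))
    agrees′ {x} {y} x∉G′ = mk⇔ to from
      where
      x∉G : inj₁ x ∉ G
      x∉G = x∉G′ ∘ G⊆G′
      to : (x , y) ∈ ((a , t) ∷ (N ─ ab∈N)) → (x , y) ∈ M
      to (here refl) = contradiction a∈G′ x∉G′
      to (there e∈)  = Equivalence.to (agrees x∉G) (∈-─⁻ ab∈N e∈)
      from : (x , y) ∈ M → (x , y) ∈ ((a , t) ∷ (N ─ ab∈N))
      from xy∈M = there (∈-─⁺ ab∈N (Equivalence.from (agrees x∉G) xy∈M) λ { refl → x∉G′ a∈G′ })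

  AlmostCovers-swap : ∀ {G a b} (p : inj₂ b ∈ G) → Freeable (inj₁ a ∷ (G ─ p)) b →
                      AlmostCovers G → AlmostCovers (inj₁ a ∷ (G ─ p))
  AlmostCovers-swap {b = b} p free-b almost x y xy∈Z with almost x y xy∈Z
  ... | inj₁ x∈G          = inj₁ (⊆ʳ-swap p x∈G)
  ... | inj₂ (inj₂ free-y) = inj₂ (inj₂ (Freeable-mono (⊆ʳ-swap p) free-y))
  ... | inj₂ (inj₁ y∈G) with y ≟ b
  ...   | yes refl = inj₂ (inj₂ free-b)
  ...   | no y≢b   = inj₂ (inj₁ (there (∈-─⁺ p y∈G (y≢b ∘ Sum.inj₂-injective))))

  exchange : ∀ {G} → Unique G → AlmostCovers G → Missed Z G →
             ∃ λ G′ → Unique G′ × length G′ ≡ length G × columnCount G ≡ suc (columnCount G′) ×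
                      G ⊆ʳ G′ × AlmostCovers G′
  exchange {G} unique almost (a , t , at∈Z , a∉G , t∉G) with almost a t at∈Z
  ... | inj₁ a∈G          = contradiction a∈G a∉G
  ... | inj₂ (inj₁ t∈G)   = contradiction t∈G t∉G
  ... | inj₂ (inj₂ free-t) with missedRow-matched a∉G at∈Z free-t
  ...   | b , ab∈M =
    inj₁ a ∷ (G ─ b∈G) , Unique-swap b∈G a∉G unique , sym (length-─ b∈G) , columnCount-─ b∈G ,
    ⊆ʳ-swap b∈G , AlmostCovers-swap b∈G free-b almost
    where
    b∈G : inj₂ b ∈ G
    b∈G = partnerColumn∈ almost a∉G ab∈M
    free-b : Freeable (inj₁ a ∷ (G ─ b∈G)) b
    free-b = Freeable-shift (⊆ʳ-swap b∈G) (here refl) a∉G at∈Z ab∈M free-t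

  extendToCover : ∀ c {G} → columnCount G ≡ c → Unique G → AlmostCovers G →
                  ∃ λ G′ → IsCoverOfSize Z (length G) G′ × G ⊆ʳ G′
  extendToCover c {G} count unique almost with covers-or-missed Z G
  ... | inj₁ covers = G , (unique , refl , covers) , id
  ... | inj₂ missed with exchange unique almost missed
  ...   | G′ , unique′ , len , count′ , G⊆G′ , almost′ with c
  ...     | zero  = contradiction (trans (sym count′) count) λ ()
  ...     | suc c′ with extendToCover c′ (suc-injective (trans (sym count′) count)) unique′ almost′
  ...       | G″ , (unique″ , len″ , covers″) , G′⊆G″ =
    G″ , (unique″ , trans len″ len , covers″) , G′⊆G″ ∘ G⊆G′

  coverContainingRow : ∀ {i j t F} → AvoidsColumn j M → IsCoverOfSize (addPos Z (i , j)) t F →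
                       ∃ λ G → IsCoverOfSize Z t G × F ⊆ʳ G × inj₁ i ∈ G
  coverContainingRow {i} {F = F} M-avoids (unique , refl , covers) with inj₁ i ∈? F
  ... | yes i∈F = F , (unique , refl , Covers-addPos⁻ covers) , id , i∈F
  ... | no i∉F with newColumn∈ covers i∉F
  ...   | j∈F with extendToCover _ refl (Unique-swap j∈F i∉F unique)
                     (AlmostCovers-swap j∈F (M-freeable M-avoids) (Covers⇒AlmostCovers (Covers-addPos⁻ covers)))
  ...     | G , (unique′ , len , covers′) , F′⊆G =
    G , (unique′ , trans len (sym (length-─ j∈F)) , covers′) , F′⊆G ∘ ⊆ʳ-swap j∈F , F′⊆G (here refl)

rows-∪⁅⁆ : ∀ {m n} {X : Subset m} {i} {G : List (File m n)} →
           (∀ x → x ∈ₛ X → inj₁ x ∈ G) → inj₁ i ∈ G → ∀ x → x ∈ₛ X ∪ ⁅ i ⁆ → inj₁ x ∈ G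
rows-∪⁅⁆ {X = X} {i} X⊆G i∈G x x∈X∪i with x∈p∪q⁻ X ⁅ i ⁆ x∈X∪i
... | inj₁ x∈X = X⊆G x x∈X
... | inj₂ x∈i = subst (λ z → inj₁ z ∈ _) (sym (x∈⁅y⁆⇒x≡y i x∈i)) i∈G

I-addPos⁺ : ∀ {m n k} {Z : PosSet m n} {i j X} → I k Z (X ∪ ⁅ i ⁆) → I k (addPos Z (i , j)) X
I-addPos⁺ {i = i} {X = X} (F , (unique , len , covers) , X∪i⊆F) =
  F , (unique , len , Covers-addPos⁺ covers (X∪i⊆F i (q⊆p∪q X ⁅ i ⁆ (x∈⁅x⁆ i)))) ,
  λ x x∈X → X∪i⊆F x (p⊆p∪q ⁅ i ⁆ x∈X)

I-addPos⁻ : ∀ {m n k r} {Z : PosSet m n} {i j X} → IsRank Z r → IsRank (addPos Z (i , j)) (suc r) →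
            I k (addPos Z (i , j)) X → I k Z (X ∪ ⁅ i ⁆)
I-addPos⁻ {Z = Z} rankZ rankZ′ (F , cover , X⊆F) with matching-avoiding-new-column rankZ rankZ′
... | M , M-independent , M-length , M-avoids
  with Exchange.coverContainingRow Z (proj₂ rankZ) M M-independent M-length M-avoids cover
...   | G , cover′ , F⊆G , i∈G = G , cover′ , rows-∪⁅⁆ (λ x → F⊆G ∘ X⊆F x) i∈G

mainTheorem12 : ∀ {m n} (Z : PosSet m n) (i : Fin m) (j : Fin n) →
    (∃ λ r → IsRank Z r × IsRank (addPos Z (i , j)) (suc r)) →
    ∀ (k : ℕ) → 1 ≤ k → ∀ (X : Subset m) →
    I k (addPos Z (i , j)) X ⇔ I k Z (X ∪ ⁅ i ⁆)
mainTheorem12 _ _ _ (_ , rankZ , rankZ′) k _ _ = mk⇔ (I-addPos⁻ {k = k} rankZ rankZ′) (I-addPos⁺ {k = k})
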